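{- Let $N\ge 1$, $s\ge1$ and $1\le i\le s$. For a permutation $\sigma$ of length at most $N$, the probability $Q^o_i(\sigma)$ depends only on the length of $\sigma$.
   Context: Setting: $N$ applicants labeled $1,\dots,N$ by quality ($N$ best); interview order a uniformly random $\pi\in S_N$ revealed from the left, only relative orders of seen entries observed; $s$ selections, each applicant irrevocably accepted (using a selection) or rejected; win if a selected applicant has value $N$. For $\pi$ of length $\ge k$, $\pi|_k\in S_k$ is the relabelling of its first $k$ entries by relative order; $\pi\in S_N$ is $\sigma$-prefixed ($\sigma\in S_k$) if $\pi|_k=\sigma$. For $\sigma$ of length $k$, $Q^o_i(\sigma)$ is the probability of winning with the best strategy after the decision on the $k$-th applicant, conditioned on $\pi$ being $\sigma$-prefixed and $i$ selections still being available right after the interview of the $k$-th applicant. -}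

module Defs where

open import Data.Nat using (ℕ; zero; suc; _∸_; _≡ᵇ_; _<ᵇ_)
open import Data.Nat.Properties using (_≟_)
open import Data.Bool using (Bool; true; false; not; _∧_; _∨_)
open import Data.List using (List; []; _∷_; [_]; _++_; map; concatMap; upTo; filter; filterᵇ; length; take; drop)
open import Data.List.Properties using (≡-dec)
open import Data.Integer using (+_)
open import Data.Rational using (ℚ; _/_; 0ℚ; _≤_)
open import Data.Product using (Σ; _×_)
open import Relation.Binary.PropositionalEquality using (_≡_)
open import Relation.Nullary.Decidable using (⌊_⌋)

words : ℕ → ℕ → List (List ℕ)
words m zero    = [ [] ]
words m (suc n) = concatMap (λ x → map (x ∷_) (words m n)) (upTo m)

memB : ℕ → List ℕ → Bool
memB x []       = false
memB x (y ∷ ys) = (x ≡ᵇ y) ∨ memB x ys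

distinctB : List ℕ → Bool
distinctB []       = true
distinctB (x ∷ xs) = not (memB x xs) ∧ distinctB xs

-- S_n : permutations of {0,…,n-1} in one-line notation (the value n-1 is
-- the best applicant; labels are shifted down by one w.r.t. the paper).
perms : ℕ → List (List ℕ)
perms n = filterᵇ distinctB (words n n)

rank : ℕ → List ℕ → ℕ
rank x xs = length (filterᵇ (λ y → y <ᵇ x) xs)

std : List ℕ → List ℕ
std xs = map (λ x → rank x xs) xs

restrict : ℕ → List ℕ → List ℕ
restrict k π = std (take k π)

-- A (deterministic) strategy: given the relative order of all applicants seen
-- so far (the current one being the last) and the number of selections still
-- available, decide whether to select the current applicant.
Strategy : Set
Strategy = List ℕ → ℕ → Bool

-- play S b seen future r : does S select an applicant of value b among
-- `future`, having already seen `seen` and with r selections available?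
play : Strategy → ℕ → List ℕ → List ℕ → ℕ → Bool
play S b seen []       r       = false
play S b seen (x ∷ xs) zero    = false
play S b seen (x ∷ xs) (suc r) with S (std (seen ++ [ x ])) (suc r)
... | true  = (x ≡ᵇ b) ∨ play S b (seen ++ [ x ]) xs r
... | false = play S b (seen ++ [ x ]) xs (suc r)

wins : Strategy → ℕ → ℕ → ℕ → List ℕ → Bool
wins S N k i π = play S (N ∸ 1) (take k π) (drop k π) i

prefixed : List ℕ → List ℕ → Bool
prefixed σ π = ⌊ ≡-dec _≟_ (restrict (length σ) π) σ ⌋

frac : ℕ → ℕ → ℚ
frac a zero    = 0ℚ
frac a (suc d) = (+ a) / suc d

-- Probability that strategy S wins, for uniform π ∈ S_N conditioned on being
-- σ-prefixed, with i selections available after the decision on applicant |σ|.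
winProb : Strategy → ℕ → ℕ → List ℕ → ℚ
winProb S N i σ =
  frac (length (filterᵇ (λ π → prefixed σ π ∧ wins S N (length σ) i π) (perms N)))
       (length (filterᵇ (prefixed σ) (perms N)))

IsQo : ℕ → ℕ → List ℕ → ℚ → Set
IsQo N i σ q = Σ Strategy (λ S → winProb S N i σ ≡ q) × ((S : Strategy) → winProb S N i σ ≤ q)

-- Two prefixes σ, τ ∈ S_k differ by a permutation of the positions 1,…,k. Rearranging the first
-- k entries of every π ∈ S_N by it is a bijection of S_N which sends σ-prefixed permutations to
-- τ-prefixed ones, keeps the entries after position k and commutes with relabelling by relative
-- order. Hence a strategy S used after σ wins on exactly as many permutations as the strategy
-- "undo the rearrangement, then ask S" wins on after τ, so both prefixes admit the same winning
-- probabilities. A winning probability depends only on the answers to the finitely many queries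
-- that a play can make, so these probabilities form a finite set, whose maximum Q^o_i is then the
-- same for σ and τ. It suffices to compare every σ with the identity prefix 0, 1, …, k - 1.
module Submission where

open import Defs
open import Data.Nat using (ℕ; zero; suc; _∸_; _≡ᵇ_; _<ᵇ_; _≤_; _<_; z≤n; s≤s)
open import Data.Nat.Properties
  using (_≟_; <-irrefl; ≤-refl; ≤-trans; ≤-reflexive; m≤n⇒m⊓n≡m)
open import Data.Rational as ℚ using (ℚ)
import Data.Rational.Properties as ℚ
open import Relation.Binary.Bundles using (DecTotalOrder)
open import Data.List.Extrema (DecTotalOrder.totalOrder ℚ.≤-decTotalOrder)
  using (argmax; f[xs]≤f[argmax])
open import Data.Bool using (Bool; T; true; false; not; _∧_; _∨_; T?)
open import Data.List
  using (List; []; _∷_; [_]; _++_; map; take; drop; upTo; applyUpTo; concatMap;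
         cartesianProductWith; filterᵇ; length)
open import Data.List.Properties
  using (≡-dec; length-removeAt′; length-++-≤ˡ; length-upTo; length-map; length-take;
         ∷-injective; map-applyUpTo; map-cong; map-cong-local; map-id-local; map-∘; map-++;
         drop-map; drop-all; ++-assoc; ++-identityʳ; take++drop≡id)
open import Data.List.Relation.Unary.All as All using (All; []; _∷_; all?)
import Data.List.Relation.Unary.All.Properties as AllProperties
open import Data.List.Relation.Unary.Any using (here; there; index)
open import Data.List.Relation.Unary.AllPairs using ([]; _∷_)
open import Data.List.Relation.Unary.Unique.Propositional using (Unique)
import Data.List.Relation.Unary.Unique.Propositional.Properties as Unique
open import Data.List.Relation.Unary.Unique.DecPropositional _≟_ using (unique?)
open import Data.List.Membership.Propositional using (_∈_; _─_; lose)
open import Data.List.Membership.Propositional.Properties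
open import Data.List.Membership.Propositional.Properties.WithK using (unique∧set⇒bag)
open import Data.List.Membership.DecPropositional _≟_ using (_∈?_)
open import Data.List.Relation.Binary.Permutation.Propositional
  using (_↭_; ↭-sym; ↭-trans; ↭⇒↭ₛ; module PermutationReasoning)
open import Data.List.Relation.Binary.Permutation.Propositional.Properties
  using (All-resp-↭; ∈-resp-↭; ↭-length; map⁺; ++⁺ʳ; filter-↭)
import Data.List.Relation.Binary.Permutation.Setoid.Properties as PermutationSetoid
open import Data.List.Relation.Binary.BagAndSetEquality using (∼bag⇒↭)
open import Data.Product using (Σ; _×_; _,_; proj₁; proj₂; uncurry)
open import Data.Product.Properties using () renaming (≡-dec to ×-≡-dec)
open import Data.Empty using (⊥-elim)
open import Function using (id; _∘_; mk⇔)
open import Relation.Nullary using (Dec; does; yes; no; ¬?)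
open import Relation.Nullary.Decidable
  using (isYes; isYes≗does; does-⇔; toWitness; fromWitness)
open import Relation.Binary.PropositionalEquality hiding ([_])

-- Permutations in one-line notation

distinctB≡unique? : ∀ xs → distinctB xs ≡ isYes (unique? xs)
distinctB≡unique? xs = trans (distinctB≡does xs) (sym (isYes≗does (unique? xs)))
  where
  not-memB≡all? : ∀ x ys → not (memB x ys) ≡ does (all? (λ y → ¬? (x ≟ y)) ys)
  not-memB≡all? x [] = refl
  not-memB≡all? x (y ∷ ys) with x ≡ᵇ y
  ... | true  = refl
  ... | false = not-memB≡all? x ys
  distinctB≡does : ∀ ys → distinctB ys ≡ does (unique? ys)
  distinctB≡does [] = refl
  distinctB≡does (y ∷ ys) = cong₂ _∧_ (not-memB≡all? y ys) (distinctB≡does ys)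

Unique-resp-↭ : ∀ {xs ys : List ℕ} → xs ↭ ys → Unique xs → Unique ys
Unique-resp-↭ xs↭ys =
  PermutationSetoid.AllPairs-resp-↭ (setoid ℕ) (_∘ sym) (resp₂ _) (↭⇒↭ₛ xs↭ys)

words-suc : ∀ m n → words m (suc n) ≡ cartesianProductWith _∷_ (upTo m) (words m n)
words-suc m n = go (upTo m)
  where
  go : ∀ xs → concatMap (λ x → map (x ∷_) (words m n)) xs
            ≡ cartesianProductWith _∷_ xs (words m n)
  go [] = refl
  go (x ∷ xs) = cong (map (x ∷_) (words m n) ++_) (go xs)

∈-words⁻ : ∀ m n {xs} → xs ∈ words m n → length xs ≡ n × All (_< m) xs
∈-words⁻ m zero (here refl) = refl , []
∈-words⁻ m (suc n) xs∈
  with ∈-cartesianProductWith⁻ _∷_ (upTo m) (words m n) (subst (_ ∈_) (words-suc m n) xs∈)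
... | x , ys , x∈ , ys∈ , refl with ∈-words⁻ m n ys∈
...   | refl , ys<m = refl , ∈-upTo⁻ x∈ ∷ ys<m

∈-words⁺ : ∀ m {xs} → All (_< m) xs → xs ∈ words m (length xs)
∈-words⁺ m [] = here refl
∈-words⁺ m {x ∷ xs} (x<m ∷ xs<m) = subst (_ ∈_) (sym (words-suc m (length xs)))
  (∈-cartesianProductWith⁺ _∷_ (∈-upTo⁺ x<m) (∈-words⁺ m xs<m))

words-unique : ∀ m n → Unique (words m n)
words-unique m zero = [] ∷ []
words-unique m (suc n) = subst Unique (sym (words-suc m n))
  (Unique.cartesianProductWith⁺ _∷_ ∷-injective (Unique.upTo⁺ m) (words-unique m n))

∈-─ : ∀ {x y : ℕ} {xs} (x∈xs : x ∈ xs) → y ∈ xs → y ≢ x → y ∈ xs ─ x∈xs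
∈-─ (here refl)  (here refl)  y≢x = ⊥-elim (y≢x refl)
∈-─ (here refl)  (there y∈xs) _   = y∈xs
∈-─ (there x∈xs) (here refl)  _   = here refl
∈-─ (there x∈xs) (there y∈xs) y≢x = there (∈-─ x∈xs y∈xs y≢x)

Unique⇒length≤ : ∀ {xs ys : List ℕ} → Unique xs → All (_∈ ys) xs → length xs ≤ length ys
Unique⇒length≤ [] [] = z≤n
Unique⇒length≤ {ys = ys} (x∉xs ∷ xs!) (x∈ys ∷ xs⊆ys) =
  subst (_ ≤_) (sym (length-removeAt′ ys (index x∈ys))) (s≤s (Unique⇒length≤ xs! xs⊆ys─x))
  where
  xs⊆ys─x = All.zipWith (λ (x≢y , y∈ys) → ∈-─ x∈ys y∈ys (x≢y ∘ sym)) (x∉xs , xs⊆ys)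

Unique⇒↭upTo : ∀ n {xs} → length xs ≡ n → All (_< n) xs → Unique xs → xs ↭ upTo n
Unique⇒↭upTo n {xs} refl xs<n xs! = ∼bag⇒↭ (unique∧set⇒bag xs! (Unique.upTo⁺ n)
  (mk⇔ (∈-upTo⁺ ∘ All.lookup xs<n) (surjective ∘ ∈-upTo⁻)))
  where
  -- pigeonhole: otherwise t ∷ xs would be n + 1 distinct numbers below n
  surjective : ∀ {t} → t < n → t ∈ xs
  surjective {t} t<n with t ∈? xs
  ... | yes t∈xs = t∈xs
  ... | no t∉xs = ⊥-elim (<-irrefl refl (subst (suc n ≤_) (length-upTo n)
          (Unique⇒length≤ (All.tabulate (λ t∈xs t≡ → t∉xs (subst (_∈ xs) (sym t≡) t∈xs)) ∷ xs!)
                          (All.map ∈-upTo⁺ (t<n ∷ xs<n)))))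

∈-perms⁻ : ∀ n {xs} → xs ∈ perms n → xs ↭ upTo n
∈-perms⁻ n {xs} xs∈ with ∈-filter⁻ (T? ∘ distinctB) xs∈
... | xs∈words , distinct with ∈-words⁻ n n xs∈words
...   | len , xs<n =
  Unique⇒↭upTo n len xs<n (toWitness (subst T (distinctB≡unique? xs) distinct))

∈-perms⁺ : ∀ n {xs} → xs ↭ upTo n → xs ∈ perms n
∈-perms⁺ n {xs} xs↭ = ∈-filter⁺ (T? ∘ distinctB)
  (subst (λ m → xs ∈ words n m) (trans (↭-length xs↭) (length-upTo n))
    (∈-words⁺ n (All-resp-↭ (↭-sym xs↭) (All.tabulate ∈-upTo⁻))))
  (subst T (sym (distinctB≡unique? xs))
    (fromWitness (Unique-resp-↭ (↭-sym xs↭) (Unique.upTo⁺ n))))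

perms-unique : ∀ n → Unique (perms n)
perms-unique n = Unique.filter⁺ (T? ∘ distinctB) (words-unique n n)

length-↭upTo : ∀ {k xs} → xs ↭ upTo k → length xs ≡ k
length-↭upTo {k} xs↭ = trans (↭-length xs↭) (length-upTo k)

↭upTo⇒< : ∀ {k n xs} → xs ↭ upTo k → k ≤ n → All (_< n) xs
↭upTo⇒< xs↭ k≤n = All-resp-↭ (↭-sym xs↭) (All.tabulate (λ j∈ → ≤-trans (∈-upTo⁻ j∈) k≤n))

-- Rearranging a prefix

infixl 5 _!_
_!_ : List ℕ → ℕ → ℕ
[] ! _ = 0
(x ∷ xs) ! zero = x
(x ∷ xs) ! suc j = xs ! j

map-! : ∀ (g : ℕ → ℕ) xs {j} → j < length xs → map g xs ! j ≡ g (xs ! j)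
map-! g (x ∷ xs) {zero} _ = refl
map-! g (x ∷ xs) {suc j} (s≤s j<) = map-! g xs j<

++-!ˡ : ∀ xs ys {j} → j < length xs → (xs ++ ys) ! j ≡ xs ! j
++-!ˡ (x ∷ xs) ys {zero} _ = refl
++-!ˡ (x ∷ xs) ys {suc j} (s≤s j<) = ++-!ˡ xs ys j<

applyUpTo-! : ∀ (f : ℕ → ℕ) n {j} → j < n → applyUpTo f n ! j ≡ f j
applyUpTo-! f (suc n) {zero} _ = refl
applyUpTo-! f (suc n) {suc j} (s≤s j<n) = applyUpTo-! (f ∘ suc) n j<n

map-!-upTo : ∀ k xs → k ≤ length xs → map (xs !_) (upTo k) ≡ take k xs
map-!-upTo k xs k≤ = trans (map-applyUpTo id (xs !_) k) (applyUpTo-!≡take k xs k≤)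
  where
  applyUpTo-!≡take : ∀ k xs → k ≤ length xs → applyUpTo (xs !_) k ≡ take k xs
  applyUpTo-!≡take zero xs _ = refl
  applyUpTo-!≡take (suc k) (x ∷ xs) (s≤s k≤) = cong (x ∷_) (applyUpTo-!≡take k xs k≤)

indexOf : List ℕ → ℕ → ℕ
indexOf [] t = 0
indexOf (x ∷ xs) t with t ≟ x
... | yes _ = 0
... | no _  = suc (indexOf xs t)

!-indexOf : ∀ {t} xs → t ∈ xs → xs ! indexOf xs t ≡ t
!-indexOf {t} (x ∷ xs) t∈ with t ≟ x
... | yes t≡x = sym t≡x
!-indexOf (x ∷ xs) (here t≡x)   | no t≢x = ⊥-elim (t≢x t≡x)
!-indexOf (x ∷ xs) (there t∈xs) | no _   = !-indexOf xs t∈xs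

map-indexOf-self : ∀ {xs} → Unique xs → map (indexOf xs) xs ≡ upTo (length xs)
map-indexOf-self [] = refl
map-indexOf-self {x ∷ xs} (x∉xs ∷ xs!) with x ≟ x
... | no x≢x = ⊥-elim (x≢x refl)
... | yes _ = cong (0 ∷_) (begin
  map (indexOf (x ∷ xs)) xs      ≡⟨ map-cong-local (All.map shift x∉xs) ⟩
  map (suc ∘ indexOf xs) xs      ≡⟨ map-∘ xs ⟩
  map suc (map (indexOf xs) xs)  ≡⟨ cong (map suc) (map-indexOf-self xs!) ⟩
  map suc (upTo (length xs))     ≡⟨ map-applyUpTo id suc (length xs) ⟩
  applyUpTo suc (length xs)      ∎)
  where
  open ≡-Reasoning
  shift : ∀ {t} → x ≢ t → indexOf (x ∷ xs) t ≡ suc (indexOf xs t)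
  shift {t} x≢t with t ≟ x
  ... | yes t≡x = ⊥-elim (x≢t (sym t≡x))
  ... | no _    = refl

take-++ : ∀ {n} (xs ys : List ℕ) → length xs ≡ n → take n (xs ++ ys) ≡ xs
take-++ [] ys refl = refl
take-++ (x ∷ xs) ys refl = cong (x ∷_) (take-++ xs ys refl)

drop-++ : ∀ {n} (xs ys : List ℕ) → length xs ≡ n → drop n (xs ++ ys) ≡ ys
drop-++ [] ys refl = refl
drop-++ (x ∷ xs) ys refl = drop-++ xs ys refl

drop-++ˡ : ∀ n (xs ys : List ℕ) → n ≤ length xs → drop n (xs ++ ys) ≡ drop n xs ++ ys
drop-++ˡ zero xs ys _ = refl
drop-++ˡ (suc n) (x ∷ xs) ys (s≤s n≤) = drop-++ˡ n xs ys n≤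

length-take≡ : ∀ k (xs : List ℕ) → k ≤ length xs → length (take k xs) ≡ k
length-take≡ k xs k≤ = trans (length-take k xs) (m≤n⇒m⊓n≡m k≤)

length-filterᵇ-↭ : ∀ {A : Set} (f : A → Bool) {xs ys} → xs ↭ ys →
                   length (filterᵇ f xs) ≡ length (filterᵇ f ys)
length-filterᵇ-↭ f = ↭-length ∘ filter-↭ (T? ∘ f)

permute : List ℕ → List ℕ → List ℕ
permute p xs = map (xs !_) p ++ drop (length p) xs

permute-upTo : ∀ k xs → k ≤ length xs → permute (upTo k) xs ≡ xs
permute-upTo k xs k≤ = begin
  map (xs !_) (upTo k) ++ drop (length (upTo k)) xs
    ≡⟨ cong₂ _++_ (map-!-upTo k xs k≤) (cong (λ n → drop n xs) (length-upTo k)) ⟩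
  take k xs ++ drop k xs
    ≡⟨ take++drop≡id k xs ⟩
  xs ∎
  where open ≡-Reasoning

permute-exact : ∀ p xs → length xs ≤ length p → permute p xs ≡ map (xs !_) p
permute-exact p xs len≤ =
  trans (cong (map (xs !_) p ++_) (drop-all (length p) xs len≤)) (++-identityʳ _)

module _ {k : ℕ} {p : List ℕ} (p↭upTo : p ↭ upTo k) where

  private
    length-p : length p ≡ k
    length-p = length-↭upTo p↭upTo

    p<_ : ∀ {n} → k ≤ n → All (_< n) p
    p<_ = ↭upTo⇒< p↭upTo

  permute-++ : ∀ xs ys → k ≤ length xs → permute p (xs ++ ys) ≡ permute p xs ++ ys
  permute-++ xs ys k≤ = begin
    map ((xs ++ ys) !_) p ++ drop (length p) (xs ++ ys)
      ≡⟨ cong₂ _++_ (map-cong-local (All.map (++-!ˡ xs ys) (p< k≤)))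
                    (drop-++ˡ (length p) xs ys (subst (_≤ length xs) (sym length-p) k≤)) ⟩
    map (xs !_) p ++ (drop (length p) xs ++ ys)
      ≡⟨ sym (++-assoc (map (xs !_) p) _ ys) ⟩
    permute p xs ++ ys ∎
    where open ≡-Reasoning

  map-permute : ∀ (g : ℕ → ℕ) xs → k ≤ length xs → map g (permute p xs) ≡ permute p (map g xs)
  map-permute g xs k≤ = begin
    map g (map (xs !_) p ++ drop (length p) xs)
      ≡⟨ map-++ g (map (xs !_) p) _ ⟩
    map g (map (xs !_) p) ++ map g (drop (length p) xs)
      ≡⟨ cong₂ _++_ (trans (sym (map-∘ p)) (map-cong-local (All.map (sym ∘ map-! g xs) (p< k≤))))
                    (sym (drop-map (length p) xs)) ⟩
    permute p (map g xs) ∎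
    where open ≡-Reasoning

  permute-↭ : ∀ xs → k ≤ length xs → permute p xs ↭ xs
  permute-↭ xs k≤ = begin
    map (xs !_) p ++ drop (length p) xs
      ↭⟨ ++⁺ʳ _ (map⁺ (xs !_) p↭upTo) ⟩
    map (xs !_) (upTo k) ++ drop (length p) xs
      ≡⟨ cong₂ _++_ (map-!-upTo k xs k≤) (cong (λ n → drop n xs) length-p) ⟩
    take k xs ++ drop k xs
      ≡⟨ take++drop≡id k xs ⟩
    xs ∎
    where open PermutationReasoning

  length-permute : ∀ xs → k ≤ length xs → length (permute p xs) ≡ length xs
  length-permute xs k≤ = ↭-length (permute-↭ xs k≤)

  std-permute : ∀ xs → k ≤ length xs → std (permute p xs) ≡ permute p (std xs)
  std-permute xs k≤ = begin
    map (λ x → rank x (permute p xs)) (permute p xs)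
      ≡⟨ map-cong (λ x → length-filterᵇ-↭ (_<ᵇ x) (permute-↭ xs k≤)) (permute p xs) ⟩
    map (λ x → rank x xs) (permute p xs)
      ≡⟨ map-permute (λ x → rank x xs) xs k≤ ⟩
    permute p (std xs) ∎
    where open ≡-Reasoning

  permute-take++drop : ∀ xs → k ≤ length xs → permute p xs ≡ permute p (take k xs) ++ drop k xs
  permute-take++drop xs k≤ = trans (cong (permute p) (sym (take++drop≡id k xs)))
    (permute-++ (take k xs) (drop k xs) (≤-reflexive (sym (length-take≡ k xs k≤))))

  take-permute : ∀ xs → k ≤ length xs → take k (permute p xs) ≡ permute p (take k xs)
  take-permute xs k≤ =
    trans (cong (take k) (permute-take++drop xs k≤)) (take-++ _ (drop k xs) length-prefix)
    where
    length-prefix : length (permute p (take k xs)) ≡ k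
    length-prefix = trans (length-permute (take k xs) (≤-reflexive (sym (length-take≡ k xs k≤))))
                          (length-take≡ k xs k≤)

  drop-permute : ∀ xs → drop k (permute p xs) ≡ drop k xs
  drop-permute xs = trans (drop-++ (map (xs !_) p) _ (trans (length-map (xs !_) p) length-p))
                          (cong (λ n → drop n xs) length-p)

  permute-permute : ∀ {q} → q ↭ upTo k → ∀ xs → k ≤ length xs →
                    permute q (permute p xs) ≡ permute (map (p !_) q) xs
  permute-permute {q} q↭upTo xs k≤ = cong₂ _++_
    (begin
      map (permute p xs !_) q         ≡⟨ map-cong-local (All.map !-permute (↭upTo⇒< q↭upTo ≤-refl)) ⟩
      map ((xs !_) ∘ (p !_)) q        ≡⟨ map-∘ q ⟩
      map (xs !_) (map (p !_) q)      ∎)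
    (begin
      drop (length q) (permute p xs)  ≡⟨ cong (λ n → drop n (permute p xs)) length-q ⟩
      drop k (permute p xs)           ≡⟨ drop-permute xs ⟩
      drop k xs                       ≡⟨ cong (λ n → drop n xs) (sym length-map-q) ⟩
      drop (length (map (p !_) q)) xs ∎)
    where
    open ≡-Reasoning
    length-q : length q ≡ k
    length-q = length-↭upTo q↭upTo
    length-map-q : length (map (p !_) q) ≡ k
    length-map-q = trans (length-map (p !_) q) length-q
    !-permute : ∀ {j} → j < k → permute p xs ! j ≡ xs ! (p ! j)
    !-permute {j} j<k = begin
      (map (xs !_) p ++ drop (length p) xs) ! j
        ≡⟨ ++-!ˡ (map (xs !_) p) _ (subst (j <_) (sym (trans (length-map (xs !_) p) length-p)) j<k) ⟩
      map (xs !_) p ! j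
        ≡⟨ map-! (xs !_) p (subst (j <_) (sym length-p) j<k) ⟩
      xs ! (p ! j) ∎

record PrefixPermutation (k : ℕ) : Set where
  field
    forward backward : List ℕ
    forward↭upTo     : forward ↭ upTo k
    backward↭upTo    : backward ↭ upTo k
    backward-forward : map (forward !_) backward ≡ upTo k
    forward-backward : map (backward !_) forward ≡ upTo k

inverse : ∀ {k} → PrefixPermutation k → PrefixPermutation k
inverse P = record
  { forward = backward ; backward = forward
  ; forward↭upTo = backward↭upTo ; backward↭upTo = forward↭upTo
  ; backward-forward = forward-backward ; forward-backward = backward-forward }
  where open PrefixPermutation P

permute-backward-forward : ∀ {k} (P : PrefixPermutation k) xs → k ≤ length xs →
  permute (PrefixPermutation.backward P) (permute (PrefixPermutation.forward P) xs) ≡ xs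
permute-backward-forward {k} P xs k≤ = begin
  permute backward (permute forward xs)   ≡⟨ permute-permute forward↭upTo backward↭upTo xs k≤ ⟩
  permute (map (forward !_) backward) xs  ≡⟨ cong (λ r → permute r xs) backward-forward ⟩
  permute (upTo k) xs                     ≡⟨ permute-upTo k xs k≤ ⟩
  xs                                      ∎
  where
  open PrefixPermutation P
  open ≡-Reasoning

module _ {k σ} (σ↭upTo : σ ↭ upTo k) where

  private
    σ⁻¹ : List ℕ
    σ⁻¹ = map (indexOf σ) (upTo k)

    σ! : Unique σ
    σ! = Unique-resp-↭ (↭-sym σ↭upTo) (Unique.upTo⁺ k)

    map-indexOf-σ : map (indexOf σ) σ ≡ upTo k
    map-indexOf-σ = trans (map-indexOf-self σ!) (cong upTo (length-↭upTo σ↭upTo))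

    σ⁻¹-! : ∀ {t} → t < k → σ⁻¹ ! t ≡ indexOf σ t
    σ⁻¹-! {t} t<k = trans (map-! (indexOf σ) (upTo k) (subst (t <_) (sym (length-upTo k)) t<k))
                          (cong (indexOf σ) (applyUpTo-! id k t<k))

  prefixPermutation : PrefixPermutation k
  prefixPermutation = record
    { forward = σ ; backward = σ⁻¹
    ; forward↭upTo = σ↭upTo
    ; backward↭upTo = PermutationReasoning.begin
        σ⁻¹                PermutationReasoning.↭⟨ map⁺ (indexOf σ) (↭-sym σ↭upTo) ⟩
        map (indexOf σ) σ  PermutationReasoning.≡⟨ map-indexOf-σ ⟩
        upTo k             PermutationReasoning.∎
    ; backward-forward = begin
        map (σ !_) σ⁻¹                     ≡⟨ sym (map-∘ (upTo k)) ⟩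
        map ((σ !_) ∘ indexOf σ) (upTo k)  ≡⟨ map-id-local (All.tabulate (λ t∈ →
                                                !-indexOf σ (∈-resp-↭ (↭-sym σ↭upTo) t∈))) ⟩
        upTo k                             ∎
    ; forward-backward = begin
        map (σ⁻¹ !_) σ     ≡⟨ map-cong-local (All.map σ⁻¹-! (↭upTo⇒< σ↭upTo ≤-refl)) ⟩
        map (indexOf σ) σ  ≡⟨ map-indexOf-σ ⟩
        upTo k             ∎ }
    where open ≡-Reasoning

  permute-forward-upTo : permute σ (upTo k) ≡ σ
  permute-forward-upTo = trans
    (permute-exact σ (upTo k) (≤-reflexive (trans (length-upTo k) (sym (length-↭upTo σ↭upTo)))))
    (map-id-local (All.map (applyUpTo-! id k) (↭upTo⇒< σ↭upTo ≤-refl)))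

  permute-backward-self : permute (PrefixPermutation.backward prefixPermutation) σ ≡ upTo k
  permute-backward-self = trans
    (permute-exact σ⁻¹ σ
      (≤-reflexive (trans (length-↭upTo σ↭upTo) (sym (length-↭upTo backward↭upTo)))))
    backward-forward
    where open PrefixPermutation prefixPermutation

-- Transfer of strategies

play-transfer : ∀ (S T : Strategy) (R : List ℕ → List ℕ → Set) →
                (∀ {z z′} y → R z z′ → R (z ++ [ y ]) (z′ ++ [ y ])) →
                (∀ {z z′} r → R z z′ → S (std z) r ≡ T (std z′) r) →
                ∀ {b seen seen′} xs r → R seen seen′ → play S b seen xs r ≡ play T b seen′ xs r
play-transfer S T R R-snoc R-decide [] r _ = refl
play-transfer S T R R-snoc R-decide (x ∷ xs) zero _ = refl
play-transfer S T R R-snoc R-decide {b} {seen} {seen′} (x ∷ xs) (suc r) R-seen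
  with S (std (seen ++ [ x ])) (suc r) | T (std (seen′ ++ [ x ])) (suc r)
     | R-decide (suc r) (R-snoc x R-seen)
... | true  | true  | _ =
  cong ((x ≡ᵇ b) ∨_) (play-transfer S T R R-snoc R-decide xs r (R-snoc x R-seen))
... | false | false | _ = play-transfer S T R R-snoc R-decide xs (suc r) (R-snoc x R-seen)

length-filterᵇ-map : ∀ {A B : Set} (f : A → Bool) (g : B → Bool) (h : A → B) xs →
                     (∀ {x} → x ∈ xs → f x ≡ g (h x)) →
                     length (filterᵇ f xs) ≡ length (filterᵇ g (map h xs))
length-filterᵇ-map f g h [] _ = refl
length-filterᵇ-map f g h (x ∷ xs) f≡g∘h with f x | g (h x) | f≡g∘h (here refl)
... | true  | true  | _ = cong suc (length-filterᵇ-map f g h xs (f≡g∘h ∘ there))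
... | false | false | _ = length-filterᵇ-map f g h xs (f≡g∘h ∘ there)

map-↭-self : ∀ {A : Set} {xs : List A} (f g : A → A) → Unique xs →
             (∀ {x} → x ∈ xs → f x ∈ xs) → (∀ {x} → x ∈ xs → g x ∈ xs) →
             (∀ {x} → x ∈ xs → g (f x) ≡ x) → (∀ {x} → x ∈ xs → f (g x) ≡ x) →
             map f xs ↭ xs
map-↭-self {xs = xs} f g xs! f∈ g∈ g∘f f∘g =
  ∼bag⇒↭ (unique∧set⇒bag (unique-map xs! g∘f) xs! (mk⇔ to from))
  where
  to : ∀ {y} → y ∈ map f xs → y ∈ xs
  to y∈ with ∈-map⁻ f y∈
  ... | x , x∈ , refl = f∈ x∈
  from : ∀ {y} → y ∈ xs → y ∈ map f xs
  from y∈ = subst (_∈ map f xs) (f∘g y∈) (∈-map⁺ f (g∈ y∈))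
  unique-map : ∀ {ys} → Unique ys → (∀ {x} → x ∈ ys → g (f x) ≡ x) → Unique (map f ys)
  unique-map [] _ = []
  unique-map (x∉ys ∷ ys!) g∘f′ =
    AllProperties.map⁺ (All.tabulate (λ y∈ fx≡fy → All.lookup x∉ys y∈
      (trans (sym (g∘f′ (here refl))) (trans (cong g fx≡fy) (g∘f′ (there y∈))))))
    ∷ unique-map ys! (g∘f′ ∘ there)

isYes-⇔ : ∀ {A B : Set} → (A → B) → (B → A) → (a? : Dec A) (b? : Dec B) → isYes a? ≡ isYes b?
isYes-⇔ to from a? b? =
  trans (isYes≗does a?) (trans (does-⇔ (mk⇔ to from) a? b?) (sym (isYes≗does b?)))

module _ {k} (P : PrefixPermutation k) where

  open PrefixPermutation P

  private
    φ ψ : List ℕ → List ℕ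
    φ = permute forward
    ψ = permute backward

    ψ∘φ : ∀ xs → k ≤ length xs → ψ (φ xs) ≡ xs
    ψ∘φ = permute-backward-forward P

    φ∘ψ : ∀ xs → k ≤ length xs → φ (ψ xs) ≡ xs
    φ∘ψ = permute-backward-forward (inverse P)

    length-φ : ∀ ρ → length ρ ≡ k → length (φ ρ) ≡ k
    length-φ ρ len = trans (length-permute forward↭upTo ρ (≤-reflexive (sym len))) len

    k≤take : ∀ π → k ≤ length π → k ≤ length (take k π)
    k≤take π k≤ = ≤-reflexive (sym (length-take≡ k π k≤))

    k≤restrict : ∀ π → k ≤ length π → k ≤ length (restrict k π)
    k≤restrict π k≤ = subst (k ≤_) (sym (length-map _ (take k π))) (k≤take π k≤)

    k≤perm : ∀ {N π} → k ≤ N → π ∈ perms N → k ≤ length π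
    k≤perm {N} k≤N π∈ = subst (k ≤_) (sym (length-↭upTo (∈-perms⁻ N π∈))) k≤N

  wins-permute : ∀ S N i π → k ≤ length π → wins S N k i π ≡ wins (S ∘ ψ) N k i (φ π)
  wins-permute S N i π k≤ = begin
    play S (N ∸ 1) (take k π) (drop k π) i
      ≡⟨ play-transfer S (S ∘ ψ) Related snoc decide (drop k π) i
                       (k≤take π k≤ , take-permute forward↭upTo π k≤) ⟩
    play (S ∘ ψ) (N ∸ 1) (take k (φ π)) (drop k π) i
      ≡⟨ cong (λ xs → play (S ∘ ψ) (N ∸ 1) (take k (φ π)) xs i)
              (sym (drop-permute forward↭upTo π)) ⟩
    play (S ∘ ψ) (N ∸ 1) (take k (φ π)) (drop k (φ π)) i ∎
    where
    open ≡-Reasoning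
    Related : List ℕ → List ℕ → Set
    Related z z′ = k ≤ length z × z′ ≡ φ z
    snoc : ∀ {z z′} y → Related z z′ → Related (z ++ [ y ]) (z′ ++ [ y ])
    snoc {z} y (k≤z , refl) =
      ≤-trans k≤z (length-++-≤ˡ z) , sym (permute-++ forward↭upTo z [ y ] k≤z)
    decide : ∀ {z z′} r → Related z z′ → S (std z) r ≡ S (ψ (std z′)) r
    decide {z} r (k≤z , refl) = cong (λ ρ → S ρ r) (sym (begin
      ψ (std (φ z))  ≡⟨ cong ψ (std-permute forward↭upTo z k≤z) ⟩
      ψ (φ (std z))  ≡⟨ ψ∘φ (std z) (subst (k ≤_) (sym (length-map _ z)) k≤z) ⟩
      std z          ∎))

  restrict-permute : ∀ π → k ≤ length π → restrict k (φ π) ≡ φ (restrict k π)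
  restrict-permute π k≤ = trans (cong std (take-permute forward↭upTo π k≤))
                                (std-permute forward↭upTo (take k π) (k≤take π k≤))

  prefixed-permute : ∀ ρ π → length ρ ≡ k → k ≤ length π →
                     prefixed ρ π ≡ prefixed (φ ρ) (φ π)
  prefixed-permute ρ π len k≤ = begin
    isYes (≡-dec _≟_ (restrict (length ρ) π) ρ)
      ≡⟨ cong (λ n → isYes (≡-dec _≟_ (restrict n π) ρ)) len ⟩
    isYes (≡-dec _≟_ (restrict k π) ρ)
      ≡⟨ isYes-⇔ to from _ _ ⟩
    isYes (≡-dec _≟_ (restrict k (φ π)) (φ ρ))
      ≡⟨ cong (λ n → isYes (≡-dec _≟_ (restrict n (φ π)) (φ ρ))) (sym (length-φ ρ len)) ⟩
    isYes (≡-dec _≟_ (restrict (length (φ ρ)) (φ π)) (φ ρ)) ∎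
    where
    open ≡-Reasoning
    to : restrict k π ≡ ρ → restrict k (φ π) ≡ φ ρ
    to π|k≡ρ = trans (restrict-permute π k≤) (cong φ π|k≡ρ)
    from : restrict k (φ π) ≡ φ ρ → restrict k π ≡ ρ
    from φπ|k≡φρ = begin
      restrict k π          ≡⟨ sym (ψ∘φ (restrict k π) (k≤restrict π k≤)) ⟩
      ψ (φ (restrict k π))  ≡⟨ cong ψ (sym (restrict-permute π k≤)) ⟩
      ψ (restrict k (φ π))  ≡⟨ cong ψ φπ|k≡φρ ⟩
      ψ (φ ρ)               ≡⟨ ψ∘φ ρ (≤-reflexive (sym len)) ⟩
      ρ                     ∎

  map-permute-perms : ∀ {N} → k ≤ N → map φ (perms N) ↭ perms N
  map-permute-perms {N} k≤N = map-↭-self φ ψ (perms-unique N)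
    (λ π∈ → ∈-perms⁺ N (↭-trans (permute-↭ forward↭upTo _ (k≤perm k≤N π∈))
                                (∈-perms⁻ N π∈)))
    (λ π∈ → ∈-perms⁺ N (↭-trans (permute-↭ backward↭upTo _ (k≤perm k≤N π∈))
                                (∈-perms⁻ N π∈)))
    (λ π∈ → ψ∘φ _ (k≤perm k≤N π∈))
    (λ π∈ → φ∘ψ _ (k≤perm k≤N π∈))

  winProb-permute : ∀ N i ρ → k ≤ N → length ρ ≡ k → ∀ S →
                    winProb S N i ρ ≡ winProb (S ∘ ψ) N i (φ ρ)
  winProb-permute N i ρ k≤N len S = cong₂ frac
    (count-transfer (λ π → prefixed ρ π ∧ wins S N (length ρ) i π)
                    (λ π → prefixed (φ ρ) π ∧ wins (S ∘ ψ) N (length (φ ρ)) i π)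
                    (λ π k≤ → cong₂ _∧_ (prefixed-permute ρ π len k≤) (wins-transfer π k≤)))
    (count-transfer (prefixed ρ) (prefixed (φ ρ)) (λ π k≤ → prefixed-permute ρ π len k≤))
    where
    wins-transfer : ∀ π → k ≤ length π →
                    wins S N (length ρ) i π ≡ wins (S ∘ ψ) N (length (φ ρ)) i (φ π)
    wins-transfer π k≤ rewrite len | length-φ ρ len = wins-permute S N i π k≤
    count-transfer : ∀ (F G : List ℕ → Bool) → (∀ π → k ≤ length π → F π ≡ G (φ π)) →
                     length (filterᵇ F (perms N)) ≡ length (filterᵇ G (perms N))
    count-transfer F G F≡G∘φ = trans
      (length-filterᵇ-map F G φ (perms N) (λ π∈ → F≡G∘φ _ (k≤perm k≤N π∈)))
      (length-filterᵇ-↭ G (map-permute-perms k≤N))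

-- Existence of an optimal strategy

queries : List ℕ → List ℕ → ℕ → List (List ℕ × ℕ)
queries seen [] r = []
queries seen (x ∷ xs) zero = []
queries seen (x ∷ xs) (suc r) = (std (seen ++ [ x ]) , suc r)
  ∷ (queries (seen ++ [ x ]) xs r ++ queries (seen ++ [ x ]) xs (suc r))

AgreeOn : List (List ℕ × ℕ) → Strategy → Strategy → Set
AgreeOn qs S T = ∀ {ρ r} → (ρ , r) ∈ qs → S ρ r ≡ T ρ r

play-cong : ∀ {S T} b seen xs r → AgreeOn (queries seen xs r) S T →
            play S b seen xs r ≡ play T b seen xs r
play-cong b seen [] r _ = refl
play-cong b seen (x ∷ xs) zero _ = refl
play-cong {S} {T} b seen (x ∷ xs) (suc r) S≈T
  with S (std (seen ++ [ x ])) (suc r) | T (std (seen ++ [ x ])) (suc r) | S≈T (here refl)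
... | true  | true  | _ =
  cong ((x ≡ᵇ b) ∨_) (play-cong b (seen ++ [ x ]) xs r (S≈T ∘ there ∘ ∈-++⁺ˡ))
... | false | false | _ = play-cong b (seen ++ [ x ]) xs (suc r) (S≈T ∘ there ∘ ∈-++⁺ʳ _)

winProbQueries : ℕ → ℕ → ℕ → List (List ℕ × ℕ)
winProbQueries N k i = concatMap (λ π → queries (take k π) (drop k π) i) (perms N)

filterᵇ-cong-local : ∀ {A : Set} (f g : A → Bool) xs → (∀ {x} → x ∈ xs → f x ≡ g x) →
                     filterᵇ f xs ≡ filterᵇ g xs
filterᵇ-cong-local f g [] _ = refl
filterᵇ-cong-local f g (x ∷ xs) f≡g with f x | g x | f≡g (here refl)
... | true  | true  | _ = cong (x ∷_) (filterᵇ-cong-local f g xs (f≡g ∘ there))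
... | false | false | _ = filterᵇ-cong-local f g xs (f≡g ∘ there)

winProb-cong : ∀ {S T} N i ρ → AgreeOn (winProbQueries N (length ρ) i) S T →
               winProb S N i ρ ≡ winProb T N i ρ
winProb-cong {S} {T} N i ρ S≈T =
  cong (λ πs → frac (length πs) (length (filterᵇ (prefixed ρ) (perms N))))
    (filterᵇ-cong-local _ _ (perms N) (λ {π} π∈ → cong (prefixed ρ π ∧_)
      (play-cong (N ∸ 1) (take k π) (drop k π) i
        (S≈T ∘ ∈-concatMap⁺ (λ π → queries (take k π) (drop k π) i) ∘ lose π∈))))
  where
  k : ℕ
  k = length ρ

fromTable : List (List ℕ × ℕ) → List Bool → Strategy
fromTable [] _ _ _ = false
fromTable (_ ∷ _) [] _ _ = false
fromTable (q ∷ qs) (b ∷ bs) ρ r with ×-≡-dec (≡-dec _≟_) _≟_ q (ρ , r)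
... | yes _ = b
... | no _  = fromTable qs bs ρ r

fromTable-tabulate : ∀ S qs → AgreeOn qs (fromTable qs (map (uncurry S) qs)) S
fromTable-tabulate S (q ∷ qs) {ρ} {r} q∈ with ×-≡-dec (≡-dec _≟_) _≟_ q (ρ , r)
... | yes refl = refl
... | no q≢ρr with q∈
...   | here refl  = ⊥-elim (q≢ρr refl)
...   | there q∈qs = fromTable-tabulate S qs q∈qs

bools : ℕ → List (List Bool)
bools zero = [ [] ]
bools (suc n) = cartesianProductWith _∷_ (true ∷ false ∷ []) (bools n)

∈-bools : ∀ bs → bs ∈ bools (length bs)
∈-bools [] = here refl
∈-bools (true ∷ bs) =
  ∈-cartesianProductWith⁺ _∷_ {xs = true ∷ false ∷ []} (here refl) (∈-bools bs)
∈-bools (false ∷ bs) =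
  ∈-cartesianProductWith⁺ _∷_ {xs = true ∷ false ∷ []} (there (here refl)) (∈-bools bs)

tableStrategies : List (List ℕ × ℕ) → List Strategy
tableStrategies qs = map (fromTable qs) (bools (length qs))

tableStrategies-complete : ∀ S qs → Σ Strategy (λ T → T ∈ tableStrategies qs × AgreeOn qs T S)
tableStrategies-complete S qs =
  fromTable qs table , ∈-map⁺ (fromTable qs) table∈ , fromTable-tabulate S qs
  where
  table : List Bool
  table = map (uncurry S) qs
  table∈ : table ∈ bools (length qs)
  table∈ = subst (λ n → table ∈ bools n) (length-map (uncurry S) qs) (∈-bools table)

optimalStrategy : ℕ → ℕ → List ℕ → Strategy
optimalStrategy N i ρ =
  argmax (λ S → winProb S N i ρ) (λ _ _ → false) (tableStrategies (winProbQueries N (length ρ) i))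

optimalValue : ℕ → ℕ → List ℕ → ℚ
optimalValue N i ρ = winProb (optimalStrategy N i ρ) N i ρ

winProb≤optimalValue : ∀ N i ρ S → winProb S N i ρ ℚ.≤ optimalValue N i ρ
winProb≤optimalValue N i ρ S =
  subst (ℚ._≤ optimalValue N i ρ) (winProb-cong N i ρ (proj₂ (proj₂ table)))
    (All.lookup (f[xs]≤f[argmax] {f = λ S → winProb S N i ρ} (λ _ _ → false) (tableStrategies qs))
                (proj₁ (proj₂ table)))
  where
  qs : List (List ℕ × ℕ)
  qs = winProbQueries N (length ρ) i
  table : Σ Strategy (λ T → T ∈ tableStrategies qs × AgreeOn qs T S)
  table = tableStrategies-complete S qs

IsQo-optimalValue : ∀ N i ρ → IsQo N i ρ (optimalValue N i ρ)
IsQo-optimalValue N i ρ = (optimalStrategy N i ρ , refl) , winProb≤optimalValue N i ρ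

optimalValue-mono : ∀ N i ρ ρ′ →
                    (∀ S → Σ Strategy (λ T → winProb S N i ρ ≡ winProb T N i ρ′)) →
                    optimalValue N i ρ ℚ.≤ optimalValue N i ρ′
optimalValue-mono N i ρ ρ′ simulate =
  subst (ℚ._≤ optimalValue N i ρ′) (sym (proj₂ (simulate (optimalStrategy N i ρ))))
    (winProb≤optimalValue N i ρ′ (proj₁ (simulate (optimalStrategy N i ρ))))

optimalValue-≤-permute : ∀ N i {k} (P : PrefixPermutation k) ρ ρ′ → k ≤ N → length ρ ≡ k →
                         permute (PrefixPermutation.forward P) ρ ≡ ρ′ →
                         optimalValue N i ρ ℚ.≤ optimalValue N i ρ′
optimalValue-≤-permute N i P ρ ρ′ k≤N len φρ≡ρ′ = optimalValue-mono N i ρ ρ′ (λ S →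
  S ∘ permute backward ,
  trans (winProb-permute P N i ρ k≤N len S) (cong (winProb (S ∘ permute backward) N i) φρ≡ρ′))
  where open PrefixPermutation P

optimalValue-upTo : ∀ N i {k σ} → σ ↭ upTo k → k ≤ N →
                    optimalValue N i σ ≡ optimalValue N i (upTo k)
optimalValue-upTo N i {k} {σ} σ↭upTo k≤N = ℚ.≤-antisym
  (optimalValue-≤-permute N i (inverse P) σ (upTo k) k≤N (length-↭upTo σ↭upTo)
                          (permute-backward-self σ↭upTo))
  (optimalValue-≤-permute N i P (upTo k) σ k≤N (length-upTo k) (permute-forward-upTo σ↭upTo))
  where
  P : PrefixPermutation k
  P = prefixPermutation σ↭upTo

mainTheorem6 : (N s i : ℕ) → 1 ≤ N → 1 ≤ s → 1 ≤ i → i ≤ s →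
    (σ τ : List ℕ) → σ ∈ perms (length σ) → τ ∈ perms (length τ) →
    length σ ≤ N → length σ ≡ length τ →
    Σ ℚ (λ q → IsQo N i σ q × IsQo N i τ q)
mainTheorem6 N _ i _ _ _ _ σ τ σ∈ τ∈ k≤N k≡ =
  optimalValue N i σ , IsQo-optimalValue N i σ ,
  subst (IsQo N i τ) (sym same-value) (IsQo-optimalValue N i τ)
  where
  k : ℕ
  k = length σ
  τ↭upTo : τ ↭ upTo k
  τ↭upTo = subst (λ n → τ ↭ upTo n) (sym k≡) (∈-perms⁻ (length τ) τ∈)
  same-value : optimalValue N i σ ≡ optimalValue N i τ
  same-value = trans (optimalValue-upTo N i {k} {σ} (∈-perms⁻ k σ∈) k≤N)
                     (sym (optimalValue-upTo N i {k} {τ} τ↭upTo k≤N))
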